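{- Let $D=(E,\mathcal{F})$ be a normal binary delta-matroid. Then the twist polynomial ${}^{\partial}w_{D}(z)$ has a non-zero constant term if and only if the intersection graph $G_D$ is bipartite.
   Context: A set system is a pair $D=(E,\mathcal{F})$ with $E$ a finite set and $\mathcal{F}$ a nonempty family of subsets of $E$ (feasible sets). It is a delta-matroid if for all $X,Y\in\mathcal{F}$ and $u\in X\Delta Y$ there is $v\in X\Delta Y$ (possibly $v=u$) with $X\Delta\{u,v\}\in\mathcal{F}$. For $A\subseteq E$ the twist is $D*A=(E,\{A\Delta X: X\in\mathcal{F}\})$. The width $w(D)$ is the maximum cardinality of a feasible set minus the minimum cardinality of a feasible set. The twist polynomial is ${}^{\partial}w_{D}(z)=\sum_{A\subseteq E} z^{w(D*A)}$. For a symmetric matrix $C$ over $GF(2)$ indexed by $E$, $D(C)=(E,\{A\subseteq E: C[A]\text{ nonsingular}\})$ ($C[A]$ the principal submatrix on $A$, $C[\emptyset]$ nonsingular by convention). A normal binary delta-matroid is one of the form $D=D(C)$; $C$ is uniquely determined by $D$. The intersection graph $G_D$ has vertex set $E$, distinct $u,v$ adjacent iff $C_{u,v}=1$, and a loop at $v$ iff $C_{v,v}=1$ (a graph with a loop is not bipartite). -}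

module Defs where

open import Data.Bool using (Bool; true; false; _∧_; _xor_)
open import Data.Nat using (ℕ; zero; suc; _∸_; _⊔_; _⊓_)
open import Data.Fin using (Fin)
open import Data.Fin.Subset using (Subset; ∣_∣)
open import Data.List using (List; []; _∷_; map; filterᵇ; foldr; allFin; length; _++_)
open import Data.Vec as Vec using (Vec; []; _∷_; lookup; zipWith)
open import Data.Product using (_×_; _,_; ∃)
open import Relation.Binary.PropositionalEquality using (_≡_; _≢_)

-- GF(2) is modelled by Bool (xor = addition, ∧ = multiplication).
-- The ground set E is Fin n; subsets of E are Data.Fin.Subset (Vec Bool n).

Matrix : ℕ → Set
Matrix n = Fin n → Fin n → Bool

SymmetricMatrix : ∀ {n} → Matrix n → Set
SymmetricMatrix C = ∀ u v → C u v ≡ C v u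

allSubsets : ∀ n → List (Subset n)
allSubsets zero    = [] ∷ []
allSubsets (suc n) = map (false ∷_) (allSubsets n) ++ map (true ∷_) (allSubsets n)

elements : ∀ {n} → Subset n → List (Fin n)
elements {n} A = filterᵇ (lookup A) (allFin n)

_Δ_ : ∀ {n} → Subset n → Subset n → Subset n
A Δ B = zipWith _xor_ A B

picks : ∀ {a} {X : Set a} → List X → List (X × List X)
picks []       = []
picks (x ∷ xs) = (x , xs) ∷ map (λ { (y , ys) → (y , x ∷ ys) }) (picks xs)

xorAll : List Bool → Bool
xorAll = foldr _xor_ false

-- Determinant over GF(2) of the submatrix of M with rows `rs` and columns
-- `cs` (in the given orders), by Laplace expansion along the first row
-- (signs are irrelevant in characteristic 2).  det of the empty matrix = 1.
detGF2 : ∀ {n} → Matrix n → List (Fin n) → List (Fin n) → Bool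
detGF2 M []       cs = true
detGF2 M (r ∷ rs) cs = xorAll (map (λ { (j , cs') → M r j ∧ detGF2 M rs cs' }) (picks cs))

-- C[A] nonsingular (C[∅] nonsingular by convention, as det of empty matrix = 1).
nonsingularPrincipal : ∀ {n} → Matrix n → Subset n → Bool
nonsingularPrincipal C A = detGF2 C (elements A) (elements A)

record SetSystem (n : ℕ) : Set where
  field
    feasible : Subset n → Bool

open SetSystem public

feasibleSets : ∀ {n} → SetSystem n → List (Subset n)
feasibleSets {n} D = filterᵇ (feasible D) (allSubsets n)

twist : ∀ {n} → SetSystem n → Subset n → SetSystem n
twist D A = record { feasible = λ X → feasible D (A Δ X) }

maxList : List ℕ → ℕ
maxList = foldr _⊔_ 0

minList : ∀ (n : ℕ) → List ℕ → ℕ   -- default n is ≥ every cardinality of a subset of Fin n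
minList n = foldr _⊓_ n

-- Width: max cardinality of a feasible set minus min cardinality of a feasible set.
-- (Only meaningful for a nonempty family, which is the case for D(C) since ∅ is feasible.)
width : ∀ {n} → SetSystem n → ℕ
width {n} D = maxList (map ∣_∣ (feasibleSets D)) ∸ minList n (map ∣_∣ (feasibleSets D))

-- Twist polynomial ∂w_D(z) = Σ_{A ⊆ E} z^{w(D*A)}, represented by its
-- coefficient function: coefficient of z^k = #{A ⊆ E : w(D*A) = k}.
twistPolyCoeff : ∀ {n} → SetSystem n → ℕ → ℕ
twistPolyCoeff {n} D k = length (filterᵇ (λ A → eqℕ (width (twist D A)) k) (allSubsets n))
  where
  eqℕ : ℕ → ℕ → Bool
  eqℕ zero    zero    = true
  eqℕ zero    (suc _) = false
  eqℕ (suc _) zero    = false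
  eqℕ (suc a) (suc b) = eqℕ a b

D[_] : ∀ {n} → Matrix n → SetSystem n
D[ C ] = record { feasible = nonsingularPrincipal C }

record Graph (n : ℕ) : Set where
  field
    adj  : Fin n → Fin n → Bool   -- only consulted for distinct vertices
    loop : Fin n → Bool

open Graph public

intersectionGraph : ∀ {n} → Matrix n → Graph n
intersectionGraph C = record { adj = C ; loop = λ v → C v v }

Bipartite : ∀ {n} → Graph n → Set
Bipartite {n} G =
  (∀ v → loop G v ≡ false) ×
  ∃ λ (col : Fin n → Bool) → ∀ u v → u ≢ v → adj G u v ≡ true → col u ≢ col v

-- The constant term of the twist polynomial counts the twists D(C) * A of width 0, i.e. those
-- whose feasible sets Y (the sets with C[A Δ Y] nonsingular) all have the same size; as A itself
-- is feasible there, that size is ∣ A ∣.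
-- If Q is a colour class of a proper 2-colouring of G_D, every nonzero term of the Laplace
-- expansion of det C[X] matches the vertices of X ∩ Q with those of X ∖ Q, so ∣ Q Δ X ∣ = ∣ Q ∣
-- whenever C[X] is nonsingular. Conversely, if D(C) * A has width 0, a loop at v, or an edge uv
-- with u and v on the same side of A, gives a nonsingular C[{v}] or C[{u, v}] and hence a feasible
-- set A Δ {v} or A Δ {u, v} of a size different from ∣ A ∣; so A is a colour class.
module Submission where

open import Defs
open import Data.Bool using (Bool; true; false; not; _∧_; _xor_; T?)
open import Data.Bool.Properties
  using (xor-assoc; xor-same; xor-identityˡ; xor-identityʳ; ∧-conicalˡ; ∧-conicalʳ; ¬-not; T-≡)
open import Data.Fin using (Fin; zero; suc)
open import Data.Fin.Properties using (_≟_)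
open import Data.Fin.Subset using (Subset; ∣_∣; ⁅_⁆; inside; outside; _∩_; ∁)
  renaming (⊥ to ∅)
open import Data.Fin.Subset.Properties using (∣p∣≤n)
open import Data.List using (List; []; _∷_; map; length; filterᵇ; tabulate; allFin)
open import Data.List.Membership.Propositional using (_∈_)
open import Data.List.Membership.Propositional.Properties
  using (∈-map⁺; ∈-map⁻; ∈-++⁺ˡ; ∈-++⁺ʳ; ∈-filter⁺; ∈-filter⁻)
open import Data.List.Properties using (map-tabulate)
open import Data.List.Relation.Binary.Permutation.Propositional using (_↭_; ↭-refl; ↭-prep; ↭-swap; ↭-trans)
open import Data.List.Relation.Binary.Permutation.Propositional.Properties using (↭-length; filter-↭)
open import Data.List.Relation.Unary.Any using (here; there)
open import Data.Nat using (ℕ; zero; suc; _+_; _≤_; z≤n)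
open import Data.Nat.Properties
  using (1+n≢n; >⇒≢; m<n⇒m<1+n; n<1+n; +-suc; +-cancelʳ-≡; suc-injective; ≤-trans; ≤-reflexive;
         ≤-antisym; m≤m⊔n; m≤n⊔m; ⊔-lub; m⊓n≤m; m⊓n≤n; ⊓-glb; m∸n≡0⇒m≤n; m≤n⇒m∸n≡0; module ≤-Reasoning)
open import Data.Product using (_×_; _,_; ∃; proj₂)
open import Data.Sum using (_⊎_; inj₁; inj₂)
import Data.Sum as Sum
open import Data.Vec using ([]; _∷_; lookup)
import Data.Vec as Vec
open import Data.Vec.Properties
  using (zipWith-assoc; zipWith-identityˡ; zipWith-identityʳ; lookup-zipWith; lookup-replicate; lookup∘tabulate; lookup-map)
open import Function using (_∘_; id)
open import Function.Bundles using (_⇔_; mk⇔; Equivalence)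
open import Function.Properties.Equivalence using () renaming (trans to ⇔-trans)
open import Relation.Binary.PropositionalEquality
  using (_≡_; _≢_; refl; sym; trans; cong; cong₂; subst; module ≡-Reasoning)
open import Relation.Nullary using (yes; no; contradiction)

private variable
  n : ℕ

count : ∀ {A : Set} → (A → Bool) → List A → ℕ
count p xs = length (filterᵇ p xs)

module _ {A : Set} where

  count≢0⇒witness : ∀ (p : A → Bool) xs → count p xs ≢ 0 → ∃ λ x → p x ≡ true
  count≢0⇒witness p []       c≢0 = contradiction refl c≢0
  count≢0⇒witness p (x ∷ xs) c≢0 with p x in px
  ... | true  = x , px
  ... | false = count≢0⇒witness p xs c≢0

  count≡0⇒false : ∀ (p : A → Bool) xs {x} → count p xs ≡ 0 → x ∈ xs → p x ≡ false
  count≡0⇒false p (y ∷ ys) c≡0 x∈ with p y in py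
  count≡0⇒false p (y ∷ ys) c≡0 (here refl)  | false = py
  count≡0⇒false p (y ∷ ys) c≡0 (there x∈ys) | false = count≡0⇒false p ys c≡0 x∈ys

  count-↭ : ∀ (p : A → Bool) {xs ys} → xs ↭ ys → count p xs ≡ count p ys
  count-↭ p = ↭-length ∘ filter-↭ (T? ∘ p)

  count-∷ : ∀ {p q : A → Bool} {x y xs ys} → p x ≡ q y → count p xs ≡ count q ys →
            count p (x ∷ xs) ≡ count q (y ∷ ys)
  count-∷ {p} {q} {x} {y} px≡qy c≡ with p x | q y
  count-∷ refl c≡ | true  | true  = cong suc c≡
  count-∷ refl c≡ | false | false = c≡

  count-map : ∀ {B : Set} (p : B → Bool) (f : A → B) xs → count p (map f xs) ≡ count (p ∘ f) xs
  count-map p f []       = refl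
  count-map p f (x ∷ xs) with p (f x)
  ... | true  = cong suc (count-map p f xs)
  ... | false = count-map p f xs

  filterᵇ-map : ∀ {B : Set} (p : B → Bool) (f : A → B) xs →
                filterᵇ p (map f xs) ≡ map f (filterᵇ (p ∘ f) xs)
  filterᵇ-map p f []       = refl
  filterᵇ-map p f (x ∷ xs) with p (f x)
  ... | true  = cong (f x ∷_) (filterᵇ-map p f xs)
  ... | false = filterᵇ-map p f xs

  picks-↭ : ∀ {xs : List A} {y ys} → (y , ys) ∈ picks xs → xs ↭ y ∷ ys
  picks-↭ {x ∷ xs} (here refl) = ↭-refl
  picks-↭ {x ∷ xs} (there yys∈) with ∈-map⁻ _ yys∈
  ... | (z , zs) , zzs∈ , refl = ↭-trans (↭-prep x (picks-↭ zzs∈)) (↭-swap x z ↭-refl)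

xorAll≡true⇒true∈ : ∀ bs → xorAll bs ≡ true → true ∈ bs
xorAll≡true⇒true∈ (true  ∷ bs) _ = here refl
xorAll≡true⇒true∈ (false ∷ bs) h = there (xorAll≡true⇒true∈ bs h)

Δ-assoc : ∀ (p q r : Subset n) → (p Δ q) Δ r ≡ p Δ (q Δ r)
Δ-assoc = zipWith-assoc xor-assoc

Δ-identityˡ : ∀ (p : Subset n) → ∅ Δ p ≡ p
Δ-identityˡ = zipWith-identityˡ xor-identityˡ

Δ-identityʳ : ∀ (p : Subset n) → p Δ ∅ ≡ p
Δ-identityʳ = zipWith-identityʳ xor-identityʳ

Δ-self : ∀ (p : Subset n) → p Δ p ≡ ∅
Δ-self []      = refl
Δ-self (x ∷ p) = cong₂ _∷_ (xor-same x) (Δ-self p)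

Δ-cancelˡ : ∀ (p q : Subset n) → p Δ (p Δ q) ≡ q
Δ-cancelˡ p q = begin
  p Δ (p Δ q) ≡⟨ sym (Δ-assoc p p q) ⟩
  (p Δ p) Δ q ≡⟨ cong (_Δ q) (Δ-self p) ⟩
  ∅ Δ q       ≡⟨ Δ-identityˡ q ⟩
  q           ∎
  where open ≡-Reasoning

lookup-⁅x⁆-≢ : ∀ {x y : Fin n} → y ≢ x → lookup ⁅ x ⁆ y ≡ false
lookup-⁅x⁆-≢ {x = zero}  {zero}  y≢x = contradiction refl y≢x
lookup-⁅x⁆-≢ {x = zero}  {suc y} y≢x = lookup-replicate y outside
lookup-⁅x⁆-≢ {x = suc x} {zero}  y≢x = refl
lookup-⁅x⁆-≢ {x = suc x} {suc y} y≢x = lookup-⁅x⁆-≢ (y≢x ∘ cong suc)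

lookup-Δ⁅x⁆-≢ : ∀ (p : Subset n) {x y} → y ≢ x → lookup (p Δ ⁅ x ⁆) y ≡ lookup p y
lookup-Δ⁅x⁆-≢ p {x} {y} y≢x = begin
  lookup (p Δ ⁅ x ⁆) y          ≡⟨ lookup-zipWith _xor_ y p ⁅ x ⁆ ⟩
  lookup p y xor lookup ⁅ x ⁆ y ≡⟨ cong (lookup p y xor_) (lookup-⁅x⁆-≢ y≢x) ⟩
  lookup p y xor false          ≡⟨ xor-identityʳ (lookup p y) ⟩
  lookup p y                    ∎
  where open ≡-Reasoning

elements-tail : ∀ b (q : Subset n) → filterᵇ (lookup (b ∷ q)) (tabulate suc) ≡ map suc (elements q)
elements-tail b q = trans (cong (filterᵇ (lookup (b ∷ q))) (sym (map-tabulate id suc)))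
                          (filterᵇ-map (lookup (b ∷ q)) suc (allFin _))

elements-outside : ∀ (q : Subset n) → elements (outside ∷ q) ≡ map suc (elements q)
elements-outside = elements-tail outside

elements-inside : ∀ (q : Subset n) → elements (inside ∷ q) ≡ zero ∷ map suc (elements q)
elements-inside q = cong (zero ∷_) (elements-tail inside q)

elements-∅ : ∀ n → elements (∅ {n}) ≡ []
elements-∅ zero    = refl
elements-∅ (suc n) = trans (elements-outside ∅) (cong (map suc) (elements-∅ n))

elements-⁅x⁆ : ∀ (x : Fin n) → elements ⁅ x ⁆ ≡ x ∷ []
elements-⁅x⁆ {suc n} zero = trans (elements-inside ∅) (cong (λ xs → zero ∷ map suc xs) (elements-∅ n))
elements-⁅x⁆ (suc x) = trans (elements-outside ⁅ x ⁆) (cong (map suc) (elements-⁅x⁆ x))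

elements-inside∷⁅x⁆ : ∀ (x : Fin n) → elements (inside ∷ ⁅ x ⁆) ≡ zero ∷ suc x ∷ []
elements-inside∷⁅x⁆ x = trans (elements-inside ⁅ x ⁆) (cong (λ xs → zero ∷ map suc xs) (elements-⁅x⁆ x))

elements-⁅x⁆Δ⁅y⁆ : ∀ {x y : Fin n} → x ≢ y →
  elements (⁅ x ⁆ Δ ⁅ y ⁆) ≡ x ∷ y ∷ [] ⊎ elements (⁅ x ⁆ Δ ⁅ y ⁆) ≡ y ∷ x ∷ []
elements-⁅x⁆Δ⁅y⁆ {x = zero}  {zero}  x≢y = contradiction refl x≢y
elements-⁅x⁆Δ⁅y⁆ {x = zero}  {suc y} x≢y =
  inj₁ (trans (cong (elements ∘ (inside ∷_)) (Δ-identityˡ ⁅ y ⁆)) (elements-inside∷⁅x⁆ y))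
elements-⁅x⁆Δ⁅y⁆ {x = suc x} {zero}  x≢y =
  inj₂ (trans (cong (elements ∘ (inside ∷_)) (Δ-identityʳ ⁅ x ⁆)) (elements-inside∷⁅x⁆ x))
elements-⁅x⁆Δ⁅y⁆ {x = suc x} {suc y} x≢y =
  Sum.map (shift x y) (shift y x) (elements-⁅x⁆Δ⁅y⁆ (x≢y ∘ cong suc))
  where
  shift : ∀ a b → elements (⁅ x ⁆ Δ ⁅ y ⁆) ≡ a ∷ b ∷ [] →
          elements (outside ∷ (⁅ x ⁆ Δ ⁅ y ⁆)) ≡ suc a ∷ suc b ∷ []
  shift a b e = trans (elements-outside _) (cong (map suc) e)

∣pΔ⁅x⁆∣≡1+∣p∣ : ∀ (p : Subset n) x → lookup p x ≡ false → ∣ p Δ ⁅ x ⁆ ∣ ≡ suc ∣ p ∣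
∣pΔ⁅x⁆∣≡1+∣p∣ (false ∷ p) zero    _ = cong (suc ∘ ∣_∣) (Δ-identityʳ p)
∣pΔ⁅x⁆∣≡1+∣p∣ (true  ∷ p) (suc x) h = cong suc (∣pΔ⁅x⁆∣≡1+∣p∣ p x h)
∣pΔ⁅x⁆∣≡1+∣p∣ (false ∷ p) (suc x) h = ∣pΔ⁅x⁆∣≡1+∣p∣ p x h

1+∣pΔ⁅x⁆∣≡∣p∣ : ∀ (p : Subset n) x → lookup p x ≡ true → suc ∣ p Δ ⁅ x ⁆ ∣ ≡ ∣ p ∣
1+∣pΔ⁅x⁆∣≡∣p∣ (true  ∷ p) zero    _ = cong (suc ∘ ∣_∣) (Δ-identityʳ p)
1+∣pΔ⁅x⁆∣≡∣p∣ (true  ∷ p) (suc x) h = cong suc (1+∣pΔ⁅x⁆∣≡∣p∣ p x h)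
1+∣pΔ⁅x⁆∣≡∣p∣ (false ∷ p) (suc x) h = 1+∣pΔ⁅x⁆∣≡∣p∣ p x h

∣pΔ⁅x⁆∣≢∣p∣ : ∀ (p : Subset n) x → ∣ p Δ ⁅ x ⁆ ∣ ≢ ∣ p ∣
∣pΔ⁅x⁆∣≢∣p∣ p x eq with lookup p x in px
... | false = 1+n≢n (trans (sym (∣pΔ⁅x⁆∣≡1+∣p∣ p x px)) eq)
... | true  = 1+n≢n (trans (1+∣pΔ⁅x⁆∣≡∣p∣ p x px) (sym eq))

2+n≢n : ∀ {n} → suc (suc n) ≢ n
2+n≢n {n} = >⇒≢ (m<n⇒m<1+n (n<1+n n))

∣pΔ[⁅x⁆Δ⁅y⁆]∣≢∣p∣ : ∀ (p : Subset n) {x y} → x ≢ y → lookup p x ≡ lookup p y →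
                    ∣ p Δ (⁅ x ⁆ Δ ⁅ y ⁆) ∣ ≢ ∣ p ∣
∣pΔ[⁅x⁆Δ⁅y⁆]∣≢∣p∣ p {x} {y} x≢y px≡py
  rewrite sym (Δ-assoc p ⁅ x ⁆ ⁅ y ⁆) with lookup p y in py
... | false = 2+n≢n ∘ trans (sym (begin
  ∣ (p Δ ⁅ x ⁆) Δ ⁅ y ⁆ ∣ ≡⟨ ∣pΔ⁅x⁆∣≡1+∣p∣ (p Δ ⁅ x ⁆) y (trans (lookup-Δ⁅x⁆-≢ p (x≢y ∘ sym)) py) ⟩
  suc ∣ p Δ ⁅ x ⁆ ∣       ≡⟨ cong suc (∣pΔ⁅x⁆∣≡1+∣p∣ p x px≡py) ⟩
  suc (suc ∣ p ∣)         ∎))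
  where open ≡-Reasoning
... | true = 2+n≢n ∘ trans (begin
  suc (suc ∣ (p Δ ⁅ x ⁆) Δ ⁅ y ⁆ ∣) ≡⟨ cong suc (1+∣pΔ⁅x⁆∣≡∣p∣ (p Δ ⁅ x ⁆) y (trans (lookup-Δ⁅x⁆-≢ p (x≢y ∘ sym)) py)) ⟩
  suc ∣ p Δ ⁅ x ⁆ ∣                 ≡⟨ 1+∣pΔ⁅x⁆∣≡∣p∣ p x px≡py ⟩
  ∣ p ∣                             ∎) ∘ sym
  where open ≡-Reasoning

count-elements : ∀ (r q : Subset n) → count (lookup r) (elements q) ≡ ∣ q ∩ r ∣
count-elements []      []      = refl
count-elements (c ∷ r) (b ∷ q) = by-head c b
  where
  tail : ∀ c → count (lookup (c ∷ r)) (map suc (elements q)) ≡ ∣ q ∩ r ∣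
  tail c = trans (count-map (lookup (c ∷ r)) suc (elements q)) (count-elements r q)
  by-head : ∀ c b → count (lookup (c ∷ r)) (elements (b ∷ q)) ≡ ∣ (b ∧ c) ∷ (q ∩ r) ∣
  by-head c     outside = trans (cong (count (lookup (c ∷ r))) (elements-outside q)) (tail c)
  by-head true  inside  = trans (cong (count (lookup (true ∷ r))) (elements-inside q)) (cong suc (tail true))
  by-head false inside  = trans (cong (count (lookup (false ∷ r))) (elements-inside q)) (tail false)

∣pΔq∣+∣q∩p∣≡∣p∣+∣q∩∁p∣ : ∀ (p q : Subset n) → ∣ p Δ q ∣ + ∣ q ∩ p ∣ ≡ ∣ p ∣ + ∣ q ∩ ∁ p ∣
∣pΔq∣+∣q∩p∣≡∣p∣+∣q∩∁p∣ []          []          = refl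
∣pΔq∣+∣q∩p∣≡∣p∣+∣q∩∁p∣ (true  ∷ p) (true  ∷ q) = trans (+-suc _ _) (cong suc (∣pΔq∣+∣q∩p∣≡∣p∣+∣q∩∁p∣ p q))
∣pΔq∣+∣q∩p∣≡∣p∣+∣q∩∁p∣ (true  ∷ p) (false ∷ q) = cong suc (∣pΔq∣+∣q∩p∣≡∣p∣+∣q∩∁p∣ p q)
∣pΔq∣+∣q∩p∣≡∣p∣+∣q∩∁p∣ (false ∷ p) (true  ∷ q) = trans (cong suc (∣pΔq∣+∣q∩p∣≡∣p∣+∣q∩∁p∣ p q)) (sym (+-suc _ _))
∣pΔq∣+∣q∩p∣≡∣p∣+∣q∩∁p∣ (false ∷ p) (false ∷ q) = ∣pΔq∣+∣q∩p∣≡∣p∣+∣q∩∁p∣ p q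

-- Q is one colour class; the case u ≡ v forbids loops.
IsProperColouring : Matrix n → Subset n → Set
IsProperColouring C Q = ∀ u v → C u v ≡ true → lookup Q u ≢ lookup Q v

detGF2-balanced : ∀ (C : Matrix n) Q → IsProperColouring C Q →
  ∀ rs cs → length rs ≡ length cs → detGF2 C rs cs ≡ true →
  count (lookup Q) rs ≡ count (lookup (∁ Q)) cs
detGF2-balanced C Q proper []       []       _   _   = refl
detGF2-balanced C Q proper (r ∷ rs) cs len det
  with ∈-map⁻ _ (xorAll≡true⇒true∈ (map _ (picks cs)) det)
... | (j , cs') , pick , true≡ = begin
  count (lookup Q) (r ∷ rs)      ≡⟨ count-∷ {p = lookup Q} {q = lookup (∁ Q)} {xs = rs} {ys = cs'}
                                      colour-flip (detGF2-balanced C Q proper rs cs' len' det') ⟩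
  count (lookup (∁ Q)) (j ∷ cs') ≡⟨ sym (count-↭ (lookup (∁ Q)) cs↭) ⟩
  count (lookup (∁ Q)) cs        ∎
  where
  open ≡-Reasoning
  cs↭ : cs ↭ j ∷ cs'
  cs↭ = picks-↭ pick
  len' : length rs ≡ length cs'
  len' = suc-injective (trans len (↭-length cs↭))
  det' : detGF2 C rs cs' ≡ true
  det' = ∧-conicalʳ _ _ (sym true≡)
  colour-flip : lookup Q r ≡ lookup (∁ Q) j
  colour-flip = trans (¬-not (proper r j (∧-conicalˡ _ _ (sym true≡)))) (sym (lookup-map j not Q))

∈-allSubsets : ∀ (p : Subset n) → p ∈ allSubsets n
∈-allSubsets []                    = here refl
∈-allSubsets {suc n} (outside ∷ p) = ∈-++⁺ˡ (∈-map⁺ (outside ∷_) (∈-allSubsets p))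
∈-allSubsets {suc n} (inside ∷ p)  = ∈-++⁺ʳ (map (outside ∷_) (allSubsets n)) (∈-map⁺ (inside ∷_) (∈-allSubsets p))

≤-maxList : ∀ {x} xs → x ∈ xs → x ≤ maxList xs
≤-maxList (y ∷ xs) (here refl) = m≤m⊔n y _
≤-maxList (y ∷ xs) (there x∈)  = ≤-trans (≤-maxList xs x∈) (m≤n⊔m y _)

maxList-≤ : ∀ {k} xs → (∀ {x} → x ∈ xs → x ≤ k) → maxList xs ≤ k
maxList-≤ []       ≤k = z≤n
maxList-≤ (y ∷ xs) ≤k = ⊔-lub (≤k (here refl)) (maxList-≤ xs (≤k ∘ there))

minList-≤ : ∀ n {x} xs → x ∈ xs → minList n xs ≤ x
minList-≤ n (y ∷ xs) (here refl) = m⊓n≤m y _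
minList-≤ n (y ∷ xs) (there x∈)  = ≤-trans (m⊓n≤n y _) (minList-≤ n xs x∈)

≤-minList : ∀ {n k} xs → k ≤ n → (∀ {x} → x ∈ xs → k ≤ x) → k ≤ minList n xs
≤-minList []       k≤n k≤ = k≤n
≤-minList (y ∷ xs) k≤n k≤ = ⊓-glb (k≤ (here refl)) (≤-minList xs k≤n (k≤ ∘ there))

module _ (D : SetSystem n) where

  sizes : List ℕ
  sizes = map ∣_∣ (feasibleSets D)

  ∣feasible∣∈sizes : ∀ {Y} → feasible D Y ≡ true → ∣ Y ∣ ∈ sizes
  ∣feasible∣∈sizes {Y} Y∈D =
    ∈-map⁺ ∣_∣ (∈-filter⁺ (T? ∘ feasible D) (∈-allSubsets Y) (Equivalence.from T-≡ Y∈D))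

  sizes⊆∣feasible∣ : ∀ {k} → k ∈ sizes → ∃ λ Y → feasible D Y ≡ true × k ≡ ∣ Y ∣
  sizes⊆∣feasible∣ k∈ with ∈-map⁻ ∣_∣ k∈
  ... | Y , Y∈ , refl = Y , Equivalence.to T-≡ (proj₂ (∈-filter⁻ (T? ∘ feasible D) {xs = allSubsets n} Y∈)) , refl

  width≡0⇒equicardinal : width D ≡ 0 → ∀ {Y Z} → feasible D Y ≡ true → feasible D Z ≡ true → ∣ Y ∣ ≡ ∣ Z ∣
  width≡0⇒equicardinal w Y∈D Z∈D = ≤-antisym (≤-via-width Y∈D Z∈D) (≤-via-width Z∈D Y∈D)
    where
    ≤-via-width : ∀ {Y Z} → feasible D Y ≡ true → feasible D Z ≡ true → ∣ Y ∣ ≤ ∣ Z ∣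
    ≤-via-width {Y} {Z} Y∈D Z∈D = begin
      ∣ Y ∣           ≤⟨ ≤-maxList sizes (∣feasible∣∈sizes Y∈D) ⟩
      maxList sizes   ≤⟨ m∸n≡0⇒m≤n w ⟩
      minList n sizes ≤⟨ minList-≤ n sizes (∣feasible∣∈sizes Z∈D) ⟩
      ∣ Z ∣           ∎
      where open ≤-Reasoning

  equicardinal⇒width≡0 : ∀ {k} → k ≤ n → (∀ Y → feasible D Y ≡ true → ∣ Y ∣ ≡ k) → width D ≡ 0
  equicardinal⇒width≡0 {k} k≤n ∣feasible∣≡k =
    m≤n⇒m∸n≡0 (≤-trans (maxList-≤ sizes (≤-reflexive ∘ ≡k)) (≤-minList sizes k≤n (≤-reflexive ∘ sym ∘ ≡k)))
    where
    ≡k : ∀ {x} → x ∈ sizes → x ≡ k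
    ≡k x∈ with sizes⊆∣feasible∣ x∈
    ... | Y , Y∈D , refl = ∣feasible∣≡k Y Y∈D

feasible-twist-Δ : ∀ (D : SetSystem n) A S → feasible (twist D A) (A Δ S) ≡ feasible D S
feasible-twist-Δ D A S = cong (feasible D) (Δ-cancelˡ A S)

width-twist≡0⇒∣AΔS∣≡∣A∣ : ∀ (D : SetSystem n) {A S} → feasible D ∅ ≡ true → width (twist D A) ≡ 0 →
                          feasible D S ≡ true → ∣ A Δ S ∣ ≡ ∣ A ∣
width-twist≡0⇒∣AΔS∣≡∣A∣ D {A} {S} ∅∈D w S∈D = trans
  (width≡0⇒equicardinal (twist D A) w (trans (feasible-twist-Δ D A S) S∈D) (trans (feasible-twist-Δ D A ∅) ∅∈D))
  (cong ∣_∣ (Δ-identityʳ A))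

-- The equality test inside twistPolyCoeff is local to its definition, so it is evaluated by
-- case analysis on the width.
twistPolyCoeff₀≢0⇔ : ∀ (D : SetSystem n) → twistPolyCoeff D 0 ≢ 0 ⇔ ∃ λ A → width (twist D A) ≡ 0
twistPolyCoeff₀≢0⇔ {n} D = mk⇔ to from
  where
  to : twistPolyCoeff D 0 ≢ 0 → ∃ λ A → width (twist D A) ≡ 0
  to c≢0 with count≢0⇒witness _ (allSubsets n) c≢0
  ... | A , A-counted with width (twist D A) in w
  ... | zero  = A , w
  ... | suc _ with () ← A-counted
  from : (∃ λ A → width (twist D A) ≡ 0) → twistPolyCoeff D 0 ≢ 0
  from (A , w) c≡0 with count≡0⇒false _ (allSubsets n) c≡0 (∈-allSubsets A)
  ... | A-uncounted with width (twist D A) | w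
  ... | zero | _ with () ← A-uncounted

module _ (C : Matrix n) where

  nonsingular-∅ : nonsingularPrincipal C ∅ ≡ true
  nonsingular-∅ = subst (λ xs → detGF2 C xs xs ≡ true) (sym (elements-∅ n)) refl

  nonsingular-⁅x⁆ : ∀ {x} → C x x ≡ true → nonsingularPrincipal C ⁅ x ⁆ ≡ true
  nonsingular-⁅x⁆ {x} Cxx = subst (λ xs → detGF2 C xs xs ≡ true) (sym (elements-⁅x⁆ x)) det₁
    where
    det₁ : detGF2 C (x ∷ []) (x ∷ []) ≡ true
    det₁ rewrite Cxx = refl

  detGF2-pair : ∀ {a b} → C a a ≡ false → C a b ≡ true → C b a ≡ true →
                detGF2 C (a ∷ b ∷ []) (a ∷ b ∷ []) ≡ true
  detGF2-pair Caa Cab Cba rewrite Caa | Cab | Cba = refl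

  nonsingular-⁅x⁆Δ⁅y⁆ : SymmetricMatrix C → ∀ {x y} → x ≢ y → C x x ≡ false → C y y ≡ false →
                        C x y ≡ true → nonsingularPrincipal C (⁅ x ⁆ Δ ⁅ y ⁆) ≡ true
  nonsingular-⁅x⁆Δ⁅y⁆ symm {x} {y} x≢y Cxx Cyy Cxy with elements-⁅x⁆Δ⁅y⁆ x≢y
  ... | inj₁ xy = subst (λ xs → detGF2 C xs xs ≡ true) (sym xy) (detGF2-pair Cxx Cxy (trans (symm y x) Cxy))
  ... | inj₂ yx = subst (λ xs → detGF2 C xs xs ≡ true) (sym yx) (detGF2-pair Cyy (trans (symm y x) Cxy) Cxy)

  properColouring⇒width≡0 : ∀ Q → IsProperColouring C Q → width (twist D[ C ] Q) ≡ 0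
  properColouring⇒width≡0 Q proper = equicardinal⇒width≡0 (twist D[ C ] Q) (∣p∣≤n Q) ∣Y∣≡∣Q∣
    where
    ∣Y∣≡∣Q∣ : ∀ Y → feasible (twist D[ C ] Q) Y ≡ true → ∣ Y ∣ ≡ ∣ Q ∣
    ∣Y∣≡∣Q∣ Y X∈D = trans (cong ∣_∣ (sym (Δ-cancelˡ Q Y))) (+-cancelʳ-≡ _ _ _ (begin
      ∣ Q Δ X ∣ + ∣ X ∩ Q ∣   ≡⟨ ∣pΔq∣+∣q∩p∣≡∣p∣+∣q∩∁p∣ Q X ⟩
      ∣ Q ∣ + ∣ X ∩ ∁ Q ∣     ≡⟨ cong (∣ Q ∣ +_) balanced ⟩
      ∣ Q ∣ + ∣ X ∩ Q ∣       ∎))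
      where
      open ≡-Reasoning
      X = Q Δ Y
      balanced : ∣ X ∩ ∁ Q ∣ ≡ ∣ X ∩ Q ∣
      balanced = begin
        ∣ X ∩ ∁ Q ∣                      ≡⟨ count-elements (∁ Q) X ⟨
        count (lookup (∁ Q)) (elements X) ≡⟨ detGF2-balanced C Q proper (elements X) (elements X) refl X∈D ⟨
        count (lookup Q) (elements X)     ≡⟨ count-elements Q X ⟩
        ∣ X ∩ Q ∣                        ∎

  width≡0⇒properColouring : SymmetricMatrix C → ∀ A → width (twist D[ C ] A) ≡ 0 → IsProperColouring C A
  width≡0⇒properColouring symm A w = proper
    where
    twisted : ∀ {S} → nonsingularPrincipal C S ≡ true → ∣ A Δ S ∣ ≡ ∣ A ∣
    twisted {S} = width-twist≡0⇒∣AΔS∣≡∣A∣ D[ C ] {A} {S} nonsingular-∅ w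
    loopless : ∀ x → C x x ≡ false
    loopless x with C x x in Cxx
    ... | false = refl
    ... | true  = contradiction (twisted (nonsingular-⁅x⁆ Cxx)) (∣pΔ⁅x⁆∣≢∣p∣ A x)
    proper : IsProperColouring C A
    proper u v Cuv Au≡Av with u ≟ v
    ... | yes refl = contradiction (trans (sym Cuv) (loopless u)) λ ()
    ... | no u≢v   = ∣pΔ[⁅x⁆Δ⁅y⁆]∣≢∣p∣ A u≢v Au≡Av
                       (twisted (nonsingular-⁅x⁆Δ⁅y⁆ symm u≢v (loopless u) (loopless v) Cuv))

  properColouring⇒bipartite : ∀ Q → IsProperColouring C Q → Bipartite (intersectionGraph C)
  properColouring⇒bipartite Q proper =
    (λ v → ¬-not (λ Cvv → proper v v Cvv refl)) , lookup Q , (λ u v _ → proper u v)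

  bipartite⇒properColouring : Bipartite (intersectionGraph C) → ∃ (IsProperColouring C)
  bipartite⇒properColouring (loopless , col , proper) = Vec.tabulate col , proper′
    where
    proper′ : IsProperColouring C (Vec.tabulate col)
    proper′ u v Cuv rewrite lookup∘tabulate col u | lookup∘tabulate col v with u ≟ v
    ... | yes refl = contradiction (trans (sym Cuv) (loopless u)) λ ()
    ... | no u≢v   = proper u v u≢v Cuv

theorem4 : ∀ (n : ℕ) (C : Matrix n) → SymmetricMatrix C →
    (twistPolyCoeff D[ C ] 0 ≢ 0 ⇔ Bipartite (intersectionGraph C))
theorem4 n C symm = ⇔-trans (twistPolyCoeff₀≢0⇔ D[ C ]) (mk⇔ to from)
  where
  to : (∃ λ A → width (twist D[ C ] A) ≡ 0) → Bipartite (intersectionGraph C)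
  to (A , w) = properColouring⇒bipartite C A (width≡0⇒properColouring C symm A w)
  from : Bipartite (intersectionGraph C) → ∃ λ A → width (twist D[ C ] A) ≡ 0
  from bip with bipartite⇒properColouring C bip
  ... | Q , proper = Q , properColouring⇒width≡0 C Q proper
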